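{- Let $n\geq 4$ with $n\neq 5$, let $G_n=\mathbb{Z}_n\times\mathbb{Z}_n$, let $S=\{(i,0),(0,i),(i,i): 1\leq i\leq n-1\}\subset G_n$, and let $\Gamma(n)=\mathrm{Cay}(G_n;S)$ (vertices $G_n$, $g\sim h$ iff $h-g\in S$). Then $\Gamma(n)$ is not distance-transitive.
   Context: A graph $\Gamma$ is distance-transitive if for all vertices $u,v,x,y$ with $d(u,v)=d(x,y)$ (graph distance) there is an automorphism $\pi$ of $\Gamma$ with $\pi(u)=x$ and $\pi(v)=y$. -}

module Defs where

open import Level using (Level; _⊔_)
open import Data.Nat using (ℕ; zero; suc; _+_; _∸_; _≤_; _≤ᵇ_)
open import Data.Bool using (if_then_else_)
open import Data.Fin using (Fin; toℕ)
open import Data.Product using (_×_; _,_; Σ; ∃-syntax)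
open import Data.Sum using (_⊎_)
open import Data.Empty using (⊥)
open import Relation.Nullary using (¬_)
open import Relation.Binary.PropositionalEquality using (_≡_; _≢_)
open import Function.Definitions using (Bijective)
open import Function.Bundles using (_⇔_)

record Graph (v e : Level) : Set (Level.suc (v ⊔ e)) where
  field
    V   : Set v
    Adj : V → V → Set e

module _ {v e} (Γ : Graph v e) where
  open Graph Γ

  data Walk : V → V → ℕ → Set (v ⊔ e) where
    here : ∀ {x} → Walk x x 0
    step : ∀ {x y z k} → Adj x y → Walk y z k → Walk x z (suc k)

  IsDist : V → V → ℕ → Set (v ⊔ e)
  IsDist x y k = Walk x y k × (∀ m → Walk x y m → k ≤ m)

  Unreachable : V → V → Set (v ⊔ e)
  Unreachable x y = ∀ m → ¬ Walk x y m

  SameDist : V → V → V → V → Set (v ⊔ e)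
  SameDist u w x y = (Σ ℕ λ k → IsDist u w k × IsDist x y k)
                   ⊎ (Unreachable u w × Unreachable x y)

  IsAutomorphism : (V → V) → Set (v ⊔ e)
  IsAutomorphism π = Bijective _≡_ _≡_ π × (∀ a b → Adj a b ⇔ Adj (π a) (π b))

  DistanceTransitive : Set (v ⊔ e)
  DistanceTransitive = ∀ u w x y → SameDist u w x y →
    ∃[ π ] (IsAutomorphism π × π u ≡ x × π w ≡ y)

-- (b - a) mod n, as a natural number in [0, n), for a b : Fin n
diffMod : (n : ℕ) → Fin n → Fin n → ℕ
diffMod n a b = if toℕ a ≤ᵇ toℕ b then toℕ b ∸ toℕ a else (toℕ b + n) ∸ toℕ a

-- membership of (d₁,d₂) ∈ ℤₙ×ℤₙ (residues in [0,n)) in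
-- S = {(i,0),(0,i),(i,i) : 1 ≤ i ≤ n-1}
InS : ℕ → ℕ → Set
InS d₁ d₂ = (d₁ ≢ 0 × d₂ ≡ 0) ⊎ (d₁ ≡ 0 × d₂ ≢ 0) ⊎ (d₁ ≢ 0 × d₁ ≡ d₂)

Γ : ℕ → Graph Level.zero Level.zero
Γ n = record
  { V   = Fin n × Fin n
  ; Adj = λ { (g₁ , g₂) (h₁ , h₂) → InS (diffMod n g₁ h₁) (diffMod n g₂ h₂) }
  }

{-# OPTIONS --safe #-}

-- An automorphism π carries the local graph of a pair (u, w), the subgraph
-- induced on the common neighbours of u and w, injectively and edge-preservingly
-- into the local graph of (π u, π w).  For n ≥ 6 the pairs with differences
-- (1,2) and (1,3) are both at distance 2, but the first local graph has a
-- vertex of degree 3 while the second is a 6-cycle; the common neighbours of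
-- the second pair are found by solving the defining congruences, using that
-- subtraction in ℤₙ is injective in each argument.  For n = 4 the pairs with
-- differences (2,0) and (1,0) are adjacent, and the first local graph has four
-- non-isolated vertices (two disjoint edges) while the second has only two.
module Submission where

open import Defs
open import Data.Nat using (ℕ; _≤_)
open import Relation.Nullary using (¬_)
open import Relation.Binary.PropositionalEquality using (_≢_)

open import Level using (Level)
open import Data.Nat using (_≟_; zero; suc; _+_; _<_; _≤ᵇ_; z≤n; s≤s)
open import Data.Nat.Properties
  using (+-commutativeSemigroup; m+[n∸m]≡n; ≤ᵇ⇒≤; <⇒≤; ≤-trans; m≤n+m; <⇒≱; +-cancelʳ-≡)
open import Algebra.Properties.CommutativeSemigroup +-commutativeSemigroup using (xy∙z≈xz∙y)
open import Data.Fin using (Fin; toℕ; #_)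
open import Data.Fin.Properties using (toℕ-injective; toℕ<n; all?) renaming (_≟_ to _≟ᶠ_)
open import Data.Bool using (true; false; T)
open import Data.Unit using (tt)
open import Data.Product using (_×_; _,_; proj₁; proj₂)
open import Data.Product.Properties using (≡-dec)
open import Data.Sum using (_⊎_; inj₁; inj₂)
open import Data.Empty using (⊥)
open import Function.Bundles using (Equivalence)
open import Relation.Binary.Definitions using (Decidable)
open import Relation.Binary.PropositionalEquality using (_≡_; refl; sym; trans; subst)
open import Relation.Nullary using (Dec; ¬?; _×-dec_; _⊎-dec_; _→-dec_; contradiction; contraposition)
open import Relation.Nullary.Decidable using (True; toWitness; from-yes; from-no; map′)

_∈₂_ : ∀ {a} {A : Set a} → A → A × A → Set a
x ∈₂ pq = x ≡ proj₁ pq ⊎ x ≡ proj₂ pq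

three-distinct-∉-pair : ∀ {a} {A : Set a} {pq : A × A} {x y z : A} →
  x ∈₂ pq → y ∈₂ pq → z ∈₂ pq → x ≢ y → x ≢ z → y ≢ z → ⊥
three-distinct-∉-pair (inj₁ refl) (inj₁ refl) _           x≢y _   _   = x≢y refl
three-distinct-∉-pair (inj₂ refl) (inj₂ refl) _           x≢y _   _   = x≢y refl
three-distinct-∉-pair (inj₁ refl) (inj₂ refl) (inj₁ refl) _   x≢z _   = x≢z refl
three-distinct-∉-pair (inj₁ refl) (inj₂ refl) (inj₂ refl) _   _   y≢z = y≢z refl
three-distinct-∉-pair (inj₂ refl) (inj₁ refl) (inj₁ refl) _   _   y≢z = y≢z refl
three-distinct-∉-pair (inj₂ refl) (inj₁ refl) (inj₂ refl) _   x≢z _   = x≢z refl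

module LocalGraph {v e : Level} (G : Graph v e) where
  open Graph G

  CommonNbr : V → V → V → Set e
  CommonNbr u w c = Adj u c × Adj c w

  record LocalAdj (u w c d : V) : Set e where
    constructor local-adj
    field
      c∈N : CommonNbr u w c
      d∈N : CommonNbr u w d
      c~d : Adj c d

  automorphism-LocalAdj : ∀ {π u w u′ w′ c d} → IsAutomorphism G π →
    π u ≡ u′ → π w ≡ w′ → LocalAdj u w c d → LocalAdj u′ w′ (π c) (π d)
  automorphism-LocalAdj {π} (_ , preserves) refl refl (local-adj (u~c , c~w) (u~d , d~w) c~d) =
    local-adj (image u~c , image c~w) (image u~d , image d~w) (image c~d)
    where
    image : ∀ {a b} → Adj a b → Adj (π a) (π b)
    image {a} {b} = Equivalence.to (preserves a b)

  dist-one : ∀ {u w} → u ≢ w → Adj u w → IsDist G u w 1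
  dist-one {u} {w} u≢w u~w = step u~w here , minimal
    where
    minimal : ∀ m → Walk G u w m → 1 ≤ m
    minimal zero    here = contradiction refl u≢w
    minimal (suc _) _    = s≤s z≤n

  dist-two : ∀ {u w} c → u ≢ w → ¬ Adj u w → CommonNbr u w c → IsDist G u w 2
  dist-two {u} {w} _ u≢w u≁w (u~c , c~w) = step u~c (step c~w here) , minimal
    where
    minimal : ∀ m → Walk G u w m → 2 ≤ m
    minimal zero          here            = contradiction refl u≢w
    minimal (suc zero)    (step u~w here) = contradiction u~w u≁w
    minimal (suc (suc _)) _               = s≤s (s≤s z≤n)

  unrelated-equidistant-pairs⇒¬distance-transitive : ∀ {u w u′ w′ k} →
    IsDist G u w k → IsDist G u′ w′ k →
    (∀ π → IsAutomorphism G π → π u ≡ u′ → π w ≡ w′ → ⊥) →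
    ¬ DistanceTransitive G
  unrelated-equidistant-pairs⇒¬distance-transitive {u} {w} {u′} {w′} {k} d d′ unrelated dt
    with π , aut , πu≡u′ , πw≡w′ ← dt u w u′ w′ (inj₁ (k , d , d′)) =
    unrelated π aut πu≡u′ πw≡w′

  module _ (Adj? : Decidable Adj) where

    CommonNbr? : ∀ u w c → Dec (CommonNbr u w c)
    CommonNbr? u w c = Adj? u c ×-dec Adj? c w

    LocalAdj? : ∀ u w c d → Dec (LocalAdj u w c d)
    LocalAdj? u w c d =
      map′ (λ (c∈N , d∈N , c~d) → local-adj c∈N d∈N c~d) (λ (local-adj c∈N d∈N c~d) → c∈N , d∈N , c~d)
           (CommonNbr? u w c ×-dec CommonNbr? u w d ×-dec Adj? c d)

module _ {n : ℕ} where

  -- x + d ≡ y in ℤₙ for residues x, y, d < n: the sum wraps around at most once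
  data _⊕_≡_ (x d y : ℕ) : Set where
    exact : x + d ≡ y     → x ⊕ d ≡ y
    wrap  : x + d ≡ y + n → x ⊕ d ≡ y

  private
    <⇒≢+n : ∀ {x y} → x < n → x ≢ y + n
    <⇒≢+n {x} {y} x<n refl = <⇒≱ x<n (m≤n+m n y)

    +-wrap : ∀ {x y d s} → x + d ≡ s → y + d ≡ s + n → y ≡ x + n
    +-wrap {x} {y} {d} refl y+d≡x+d+n = +-cancelʳ-≡ d y (x + n) (trans y+d≡x+d+n (xy∙z≈xz∙y x d n))

  ⊕-functional : ∀ {x d y y′} → y < n → y′ < n → x ⊕ d ≡ y → x ⊕ d ≡ y′ → y ≡ y′
  ⊕-functional _   _    (exact s≡y)  (exact s≡y′)  = trans (sym s≡y) s≡y′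
  ⊕-functional _   _    (wrap s≡y+n) (wrap s≡y′+n) = +-cancelʳ-≡ n _ _ (trans (sym s≡y+n) s≡y′+n)
  ⊕-functional y<n _    (exact s≡y)  (wrap s≡y′+n) = contradiction (trans (sym s≡y) s≡y′+n) (<⇒≢+n y<n)
  ⊕-functional _   y′<n (wrap s≡y+n) (exact s≡y′)  = contradiction (trans (sym s≡y′) s≡y+n) (<⇒≢+n y′<n)

  ⊕-cancelʳ : ∀ {x x′ d y} → x < n → x′ < n → x ⊕ d ≡ y → x′ ⊕ d ≡ y → x ≡ x′
  ⊕-cancelʳ _   _    (exact s≡y)  (exact s′≡y)  = +-cancelʳ-≡ _ _ _ (trans s≡y (sym s′≡y))
  ⊕-cancelʳ _   _    (wrap s≡y+n) (wrap s′≡y+n) = +-cancelʳ-≡ _ _ _ (trans s≡y+n (sym s′≡y+n))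
  ⊕-cancelʳ _   x′<n (exact s≡y)  (wrap s′≡y+n) = contradiction (+-wrap s≡y s′≡y+n) (<⇒≢+n x′<n)
  ⊕-cancelʳ x<n _    (wrap s≡y+n) (exact s′≡y)  = contradiction (+-wrap s′≡y s≡y+n) (<⇒≢+n x<n)

  diffMod-spec : (a b : Fin n) → toℕ a ⊕ diffMod n a b ≡ toℕ b
  diffMod-spec a b with toℕ a ≤ᵇ toℕ b in a≤ᵇb
  ... | true  = exact (m+[n∸m]≡n (≤ᵇ⇒≤ (toℕ a) (toℕ b) (subst T (sym a≤ᵇb) tt)))
  ... | false = wrap (m+[n∸m]≡n (≤-trans (<⇒≤ (toℕ<n a)) (m≤n+m n (toℕ b))))

  diffMod-injectiveʳ : (a b b′ : Fin n) → diffMod n a b ≡ diffMod n a b′ → b ≡ b′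
  diffMod-injectiveʳ a b b′ eq = toℕ-injective (⊕-functional (toℕ<n b) (toℕ<n b′)
    (diffMod-spec a b) (subst (λ d → toℕ a ⊕ d ≡ toℕ b′) (sym eq) (diffMod-spec a b′)))

  diffMod-injectiveˡ : (a a′ b : Fin n) → diffMod n a b ≡ diffMod n a′ b → a ≡ a′
  diffMod-injectiveˡ a a′ b eq = toℕ-injective (⊕-cancelʳ (toℕ<n a) (toℕ<n a′)
    (diffMod-spec a b) (subst (λ d → toℕ a′ ⊕ d ≡ toℕ b) (sym eq) (diffMod-spec a′ b)))

0∉S : ¬ InS 0 0
0∉S (inj₁ (0≢0 , _))        = 0≢0 refl
0∉S (inj₂ (inj₁ (_ , 0≢0))) = 0≢0 refl
0∉S (inj₂ (inj₂ (0≢0 , _))) = 0≢0 refl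

off-lines∉S : ∀ {d₁ d₂} → d₁ ≢ 0 → d₂ ≢ 0 → d₁ ≢ d₂ → ¬ InS d₁ d₂
off-lines∉S _    d₂≢0 _     (inj₁ (_ , d₂≡0))         = d₂≢0 d₂≡0
off-lines∉S d₁≢0 _    _     (inj₂ (inj₁ (d₁≡0 , _)))  = d₁≢0 d₁≡0
off-lines∉S _    _    d₁≢d₂ (inj₂ (inj₂ (_ , d₁≡d₂))) = d₁≢d₂ d₁≡d₂

InS? : Decidable InS
InS? d₁ d₂ = (¬? (d₁ ≟ 0) ×-dec d₂ ≟ 0)
        ⊎-dec (d₁ ≟ 0 ×-dec ¬? (d₂ ≟ 0))
        ⊎-dec (¬? (d₁ ≟ 0) ×-dec d₁ ≟ d₂)

Adj? : ∀ n → Decidable (Graph.Adj (Γ n))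
Adj? n (g₁ , g₂) (h₁ , h₂) = InS? (diffMod n g₁ h₁) (diffMod n g₂ h₂)

module Γ[6+k] (k : ℕ) where
  n : ℕ
  n = 6 + k

  open Graph (Γ n) using (V; Adj)
  open LocalGraph (Γ n)

  -- w₁ − u = (1,2) and w₂ − u = (1,3); u is placed at (2,0) so that no
  -- common neighbour of u and w₂ has a coordinate depending on n.
  u w₁ w₂ : V
  u  = # 2 , # 0
  w₁ = # 3 , # 2
  w₂ = # 3 , # 3

  -- the common neighbours of u and w₂, in the cyclic order of the 6-cycle they induce
  data Hexagon : V → Set where
    h₀ : Hexagon (# 3 , # 0)
    h₁ : Hexagon (# 0 , # 0)
    h₂ : Hexagon (# 2 , # 2)
    h₃ : Hexagon (# 2 , # 3)
    h₄ : Hexagon (# 5 , # 3)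
    h₅ : Hexagon (# 3 , # 1)

  common-nbr-u-w₂⇒hexagon : ∀ x → CommonNbr u w₂ x → Hexagon x
  common-nbr-u-w₂⇒hexagon (X , Y) (inj₁ (_ , Y-0≡0) , x~w₂)
    with refl ← diffMod-injectiveʳ (# 0) Y (# 0) Y-0≡0 = on-row X x~w₂
    where
    on-row : ∀ X → Adj (X , # 0) w₂ → Hexagon (X , # 0)
    on-row X (inj₁ (_ , ()))
    on-row X (inj₂ (inj₁ (3-X≡0 , _)))
      with refl ← diffMod-injectiveˡ X (# 3) (# 3) 3-X≡0 = h₀
    on-row X (inj₂ (inj₂ (_ , 3-X≡3)))
      with refl ← diffMod-injectiveˡ X (# 0) (# 3) 3-X≡3 = h₁
  common-nbr-u-w₂⇒hexagon (X , Y) (inj₂ (inj₁ (X-2≡0 , _)) , x~w₂)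
    with refl ← diffMod-injectiveʳ (# 2) X (# 2) X-2≡0 = on-column Y x~w₂
    where
    on-column : ∀ Y → Adj (# 2 , Y) w₂ → Hexagon (# 2 , Y)
    on-column Y (inj₁ (_ , 3-Y≡0))
      with refl ← diffMod-injectiveˡ Y (# 3) (# 3) 3-Y≡0 = h₃
    on-column Y (inj₂ (inj₁ (() , _)))
    on-column Y (inj₂ (inj₂ (_ , 1≡3-Y)))
      with refl ← diffMod-injectiveˡ Y (# 2) (# 3) (sym 1≡3-Y) = h₂
  common-nbr-u-w₂⇒hexagon (X , Y) (inj₂ (inj₂ (_ , X-2≡Y-0)) , x~w₂) = on-diagonal x~w₂
    where
    on-diagonal : Adj (X , Y) w₂ → Hexagon (X , Y)
    on-diagonal (inj₁ (_ , 3-Y≡0))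
      with refl ← diffMod-injectiveˡ Y (# 3) (# 3) 3-Y≡0
      with refl ← diffMod-injectiveʳ (# 2) X (# 5) X-2≡Y-0 = h₄
    on-diagonal (inj₂ (inj₁ (3-X≡0 , _)))
      with refl ← diffMod-injectiveˡ X (# 3) (# 3) 3-X≡0
      with refl ← diffMod-injectiveʳ (# 0) Y (# 1) (sym X-2≡Y-0) = h₅
    on-diagonal (inj₂ (inj₂ (_ , 3-X≡3-Y)))
      with refl ← diffMod-injectiveˡ X Y (# 3) 3-X≡3-Y =
      contradiction (diffMod-injectiveˡ (# 2) (# 0) X X-2≡Y-0) λ ()

  ring : ∀ {x} → Hexagon x → V × V
  ring h₀ = (# 3 , # 1) , (# 0 , # 0)
  ring h₁ = (# 3 , # 0) , (# 2 , # 2)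
  ring h₂ = (# 0 , # 0) , (# 2 , # 3)
  ring h₃ = (# 2 , # 2) , (# 5 , # 3)
  ring h₄ = (# 2 , # 3) , (# 3 , # 1)
  ring h₅ = (# 5 , # 3) , (# 3 , # 0)

  adjacent⇒ring-neighbour : ∀ {x y} (h : Hexagon x) → Hexagon y → Adj x y → y ∈₂ ring h
  adjacent⇒ring-neighbour h₀ h₀ x~y = contradiction x~y 0∉S
  adjacent⇒ring-neighbour h₀ h₁ x~y = inj₂ refl
  adjacent⇒ring-neighbour h₀ h₂ x~y = contradiction x~y (off-lines∉S (λ ()) (λ ()) (λ ()))
  adjacent⇒ring-neighbour h₀ h₃ x~y = contradiction x~y (off-lines∉S (λ ()) (λ ()) (λ ()))
  adjacent⇒ring-neighbour h₀ h₄ x~y = contradiction x~y (off-lines∉S (λ ()) (λ ()) (λ ()))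
  adjacent⇒ring-neighbour h₀ h₅ x~y = inj₁ refl
  adjacent⇒ring-neighbour h₁ h₀ x~y = inj₁ refl
  adjacent⇒ring-neighbour h₁ h₁ x~y = contradiction x~y 0∉S
  adjacent⇒ring-neighbour h₁ h₂ x~y = inj₂ refl
  adjacent⇒ring-neighbour h₁ h₃ x~y = contradiction x~y (off-lines∉S (λ ()) (λ ()) (λ ()))
  adjacent⇒ring-neighbour h₁ h₄ x~y = contradiction x~y (off-lines∉S (λ ()) (λ ()) (λ ()))
  adjacent⇒ring-neighbour h₁ h₅ x~y = contradiction x~y (off-lines∉S (λ ()) (λ ()) (λ ()))
  adjacent⇒ring-neighbour h₂ h₀ x~y = contradiction x~y (off-lines∉S (λ ()) (λ ()) (λ ()))
  adjacent⇒ring-neighbour h₂ h₁ x~y = inj₁ refl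
  adjacent⇒ring-neighbour h₂ h₂ x~y = contradiction x~y 0∉S
  adjacent⇒ring-neighbour h₂ h₃ x~y = inj₂ refl
  adjacent⇒ring-neighbour h₂ h₄ x~y = contradiction x~y (off-lines∉S (λ ()) (λ ()) (λ ()))
  adjacent⇒ring-neighbour h₂ h₅ x~y = contradiction x~y (off-lines∉S (λ ()) (λ ()) (λ ()))
  adjacent⇒ring-neighbour h₃ h₀ x~y = contradiction x~y (off-lines∉S (λ ()) (λ ()) (λ ()))
  adjacent⇒ring-neighbour h₃ h₁ x~y = contradiction x~y (off-lines∉S (λ ()) (λ ()) (λ ()))
  adjacent⇒ring-neighbour h₃ h₂ x~y = inj₁ refl
  adjacent⇒ring-neighbour h₃ h₃ x~y = contradiction x~y 0∉S
  adjacent⇒ring-neighbour h₃ h₄ x~y = inj₂ refl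
  adjacent⇒ring-neighbour h₃ h₅ x~y = contradiction x~y (off-lines∉S (λ ()) (λ ()) (λ ()))
  adjacent⇒ring-neighbour h₄ h₀ x~y = contradiction x~y (off-lines∉S (λ ()) (λ ()) (λ ()))
  adjacent⇒ring-neighbour h₄ h₁ x~y = contradiction x~y (off-lines∉S (λ ()) (λ ()) (λ ()))
  adjacent⇒ring-neighbour h₄ h₂ x~y = contradiction x~y (off-lines∉S (λ ()) (λ ()) (λ ()))
  adjacent⇒ring-neighbour h₄ h₃ x~y = inj₁ refl
  adjacent⇒ring-neighbour h₄ h₄ x~y = contradiction x~y 0∉S
  adjacent⇒ring-neighbour h₄ h₅ x~y = inj₂ refl
  adjacent⇒ring-neighbour h₅ h₀ x~y = inj₂ refl
  adjacent⇒ring-neighbour h₅ h₁ x~y = contradiction x~y (off-lines∉S (λ ()) (λ ()) (λ ()))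
  adjacent⇒ring-neighbour h₅ h₂ x~y = contradiction x~y (off-lines∉S (λ ()) (λ ()) (λ ()))
  adjacent⇒ring-neighbour h₅ h₃ x~y = contradiction x~y (off-lines∉S (λ ()) (λ ()) (λ ()))
  adjacent⇒ring-neighbour h₅ h₄ x~y = inj₁ refl
  adjacent⇒ring-neighbour h₅ h₅ x~y = contradiction x~y 0∉S

  local-degree≤2 : ∀ {x y₁ y₂ y₃} →
    LocalAdj u w₂ x y₁ → LocalAdj u w₂ x y₂ → LocalAdj u w₂ x y₃ →
    y₁ ≢ y₂ → y₁ ≢ y₃ → y₂ ≢ y₃ → ⊥
  local-degree≤2 {x} (local-adj x∈N y₁∈N x~y₁) (local-adj _ y₂∈N x~y₂) (local-adj _ y₃∈N x~y₃) =
    three-distinct-∉-pair (on-ring y₁∈N x~y₁) (on-ring y₂∈N x~y₂) (on-ring y₃∈N x~y₃)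
    where
    x-on-hexagon : Hexagon x
    x-on-hexagon = common-nbr-u-w₂⇒hexagon x x∈N

    on-ring : ∀ {y} → CommonNbr u w₂ y → Adj x y → y ∈₂ ring x-on-hexagon
    on-ring {y} y∈N = adjacent⇒ring-neighbour x-on-hexagon (common-nbr-u-w₂⇒hexagon y y∈N)

  not-distance-transitive : ¬ DistanceTransitive (Γ n)
  not-distance-transitive = unrelated-equidistant-pairs⇒¬distance-transitive
    (dist-two (# 3 , # 0) (λ ()) (from-no (Adj? n u w₁)) (from-yes (CommonNbr? (Adj? n) u w₁ (# 3 , # 0))))
    (dist-two (# 3 , # 0) (λ ()) (from-no (Adj? n u w₂)) (from-yes (CommonNbr? (Adj? n) u w₂ (# 3 , # 0))))
    no-automorphism
    where
    hub : V
    hub = # 3 , # 1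

    no-automorphism : ∀ π → IsAutomorphism (Γ n) π → π u ≡ u → π w₁ ≡ w₂ → ⊥
    no-automorphism π aut@((π-injective , _) , _) πu≡u πw₁≡w₂ =
      local-degree≤2 (spoke (# 3 , # 0)) (spoke (# 4 , # 2)) (spoke (# 2 , # 1))
        (contraposition π-injective λ ()) (contraposition π-injective λ ()) (contraposition π-injective λ ())
      where
      spoke : ∀ d → {True (LocalAdj? (Adj? n) u w₁ hub d)} → LocalAdj u w₂ (π hub) (π d)
      spoke d {spoke?} = automorphism-LocalAdj aut πu≡u πw₁≡w₂ (toWitness spoke?)

module Γ₄ where
  open Graph (Γ 4) using (V; Adj)
  open LocalGraph (Γ 4)

  u w₁ w₂ : V
  u  = # 0 , # 0
  w₁ = # 2 , # 0
  w₂ = # 1 , # 0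

  _≟ⱽ_ : (x y : V) → Dec (x ≡ y)
  _≟ⱽ_ = ≡-dec _≟ᶠ_ _≟ᶠ_

  local-edges-u-w₂-within-pair : ∀ x y → LocalAdj u w₂ x y → x ∈₂ ((# 2 , # 0) , (# 3 , # 0))
  local-edges-u-w₂-within-pair (x₁ , x₂) (y₁ , y₂) = from-yes by-enumeration x₁ x₂ y₁ y₂
    where
    by-enumeration : Dec (∀ x₁ x₂ y₁ y₂ → LocalAdj u w₂ (x₁ , x₂) (y₁ , y₂) →
                          (x₁ , x₂) ∈₂ ((# 2 , # 0) , (# 3 , # 0)))
    by-enumeration = all? λ x₁ → all? λ x₂ → all? λ y₁ → all? λ y₂ →
      LocalAdj? (Adj? 4) u w₂ _ _
        →-dec ((x₁ , x₂) ≟ⱽ (# 2 , # 0) ⊎-dec (x₁ , x₂) ≟ⱽ (# 3 , # 0))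

  not-distance-transitive : ¬ DistanceTransitive (Γ 4)
  not-distance-transitive = unrelated-equidistant-pairs⇒¬distance-transitive
    (dist-one (λ ()) (from-yes (Adj? 4 u w₁)))
    (dist-one (λ ()) (from-yes (Adj? 4 u w₂)))
    no-automorphism
    where
    no-automorphism : ∀ π → IsAutomorphism (Γ 4) π → π u ≡ u → π w₁ ≡ w₂ → ⊥
    no-automorphism π aut@((π-injective , _) , _) πu≡u πw₁≡w₂ =
      three-distinct-∉-pair
        (non-isolated (# 1 , # 0) (# 3 , # 0))
        (non-isolated (# 3 , # 0) (# 1 , # 0))
        (non-isolated (# 0 , # 2) (# 2 , # 2))
        (contraposition π-injective λ ()) (contraposition π-injective λ ()) (contraposition π-injective λ ())
      where
      non-isolated : ∀ x y → {True (LocalAdj? (Adj? 4) u w₁ x y)} → π x ∈₂ ((# 2 , # 0) , (# 3 , # 0))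
      non-isolated x y {xy?} =
        local-edges-u-w₂-within-pair (π x) (π y) (automorphism-LocalAdj aut πu≡u πw₁≡w₂ (toWitness xy?))

theorem3p3 : (n : ℕ) → 4 ≤ n → n ≢ 5 → ¬ DistanceTransitive (Γ n)
theorem3p3 0 ()
theorem3p3 1 (s≤s ())
theorem3p3 2 (s≤s (s≤s ()))
theorem3p3 3 (s≤s (s≤s (s≤s ())))
theorem3p3 4 _ _ = Γ₄.not-distance-transitive
theorem3p3 5 _ 5≢5 = contradiction refl 5≢5
theorem3p3 (suc (suc (suc (suc (suc (suc k)))))) _ _ = Γ[6+k].not-distance-transitive k
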